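{- As formal power series in $q$, \[\sum_{\pi\in\mathcal{D}} (-1)^{\lceil\mathcal{E}\rceil(\pi)} q^{\mathcal{O}(\pi)} = (-q;-q^2)_\infty = (-q;q^4)_\infty(q^3;q^4)_\infty,\] \[\sum_{\pi\in\mathcal{P}} (-1)^{\lceil\mathcal{E}\rceil(\pi)} q^{\mathcal{O}(\pi)} = \frac{1}{(-q^2;-q^2)_\infty} = \frac{1}{(-q^2;q^4)_\infty(q^4;q^4)_\infty}.\]
   Context: A partition $\pi=(\lambda_1,\lambda_2,\dots)$ is a finite non-increasing sequence of positive integers; the empty sequence is the unique partition of $0$. $\mathcal{P}$ is the set of all partitions, $\mathcal{D}$ the set of partitions into distinct parts. $\mathcal{O}(\pi)=\lambda_1+\lambda_3+\cdots$ and $\lceil\mathcal{E}\rceil(\pi)=\lceil\lambda_2/2\rceil+\lceil\lambda_4/2\rceil+\lceil\lambda_6/2\rceil+\cdots$. $(a;q)_\infty=\prod_{i\ge0}(1-aq^i)$. -}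

module Defs where

open import Data.Nat as ℕ using (ℕ; zero; suc; _<_; _≥_; _>_; ⌈_/2⌉)
open import Data.Integer as ℤ using (ℤ; +_; -_; _*_; _+_; _-_)
open import Data.List using (List; []; _∷_; map; upTo; foldr; zipWith)
open import Data.Nat.ListAction using (sum)
open import Relation.Nullary using (yes; no)
open import Data.List.Relation.Unary.All using (All)
open import Data.List.Relation.Unary.Linked using (Linked)
open import Data.List.Relation.Unary.Unique.Propositional using (Unique)
open import Data.List.Membership.Propositional using (_∈_)
open import Data.Product using (Σ; _×_)
open import Function.Bundles using (_⇔_)
open import Relation.Binary.PropositionalEquality using (_≡_)

IsPartition : List ℕ → Set
IsPartition π = Linked _≥_ π × All (0 <_) π

IsDistinctPartition : List ℕ → Set
IsDistinctPartition π = Linked _>_ π × All (0 <_) π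

mutual
  oddParts : List ℕ → List ℕ
  oddParts []       = []
  oddParts (x ∷ xs) = x ∷ evenParts xs

  evenParts : List ℕ → List ℕ
  evenParts []       = []
  evenParts (x ∷ xs) = oddParts xs

𝒪 : List ℕ → ℕ
𝒪 π = sum (oddParts π)

⌈ℰ⌉ : List ℕ → ℕ
⌈ℰ⌉ π = sum (map ⌈_/2⌉ (evenParts π))

weight : List ℕ → ℤ
weight π = (- (+ 1)) ℤ.^ ⌈ℰ⌉ π

sumℤ : List ℤ → ℤ
sumℤ = foldr _+_ (+ 0)

-- "The coefficient of qⁿ in  Σ_{π ∈ S} (-1)^{⌈ℰ⌉(π)} q^{𝒪(π)}  equals c":
-- the set {π ∈ S : 𝒪(π) = n} is finite, listed without repetition by some L,
-- and the signed count over it is c.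
HasCoeff : (List ℕ → Set) → ℕ → ℤ → Set
HasCoeff S n c =
  Σ (List (List ℕ)) λ L →
    Unique L ×
    (∀ π → (π ∈ L) ⇔ (S π × 𝒪 π ≡ n)) ×
    sumℤ (map weight L) ≡ c

Series : Set
Series = ℕ → ℤ

_≈ₛ_ : Series → Series → Set
f ≈ₛ g = ∀ n → f n ≡ g n

oneₛ : Series
oneₛ zero    = + 1
oneₛ (suc _) = + 0

mono : ℤ → ℕ → Series
mono c m n with m ℕ.≟ n
... | yes _ = c
... | no  _ = + 0

_-ₛ_ : Series → Series → Series
(f -ₛ g) n = f n - g n

_*ₛ_ : Series → Series → Series
(f *ₛ g) n = sumℤ (map (λ k → f k * g (n ℕ.∸ k)) (upTo (suc n)))

prodUpTo : (ℕ → Series) → ℕ → Series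
prodUpTo F k = foldr (λ i acc → F i *ₛ acc) oneₛ (upTo k)

-- (c q^a ; d q^b)_∞ = ∏_{i ≥ 0} (1 - (c q^a)(d q^b)^i) = ∏_{i≥0} (1 - c dⁱ q^{a+bi}),
-- for c, d ∈ ℤ and a, b ≥ 1.  Since a, b ≥ 1, the i-th factor is
-- 1 + O(q^{i+1}), so the coefficient of qⁿ of the infinite product equals
-- that of the finite product of the factors i = 0, …, n.
poch : ℤ → ℕ → ℤ → ℕ → Series
poch c a d b n =
  prodUpTo (λ i → oneₛ -ₛ mono (c * d ℤ.^ i) (a ℕ.+ b ℕ.* i)) (suc n) n

-- Multiplicative inverse of a series with constant term 1:
-- b₀ = 1, bₙ = - Σ_{k=1}^{n} f k · b_{n-k}.
-- invRev f n = [bₙ, …, b₁, b₀].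
invRev : Series → ℕ → List ℤ
invRev f zero    = + 1 ∷ []
invRev f (suc n) =
  let bs = invRev f n in
  (- sumℤ (zipWith _*_ (map (λ k → f (suc k)) (upTo (suc n))) bs)) ∷ bs

invₛ : Series → Series
invₛ f n with invRev f n
... | []    = + 0
... | b ∷ _ = b

-- Sort the chains (partitions, or partitions into distinct parts) by their largest part. Deleting
-- the largest part exchanges odd and even positions, so besides Aₘ = Σ (-1)^{⌈ℰ⌉(π)} q^{𝒪(π)} over
-- the chains with largest part at most m one also tracks Bₘ = Σ (-1)^{⌈λ₁/2⌉+⌈λ₃/2⌉+⋯} q^{λ₂+λ₄+⋯}.
-- Adding a new largest part m + 1 gives
--   A_{m+1} = Aₘ + q^{m+1} B_{m'},   B_{m+1} = Bₘ + (-1)^{⌈(m+1)/2⌉} A_{m'},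
-- with m' = m for distinct parts and m' = m + 1 for partitions. Taken two steps at a time, these
-- give A_{2j} = ∏_{i<j} (1 + (-1)^i q^{2i+1}) for distinct parts, and for partitions
-- A_{2j} ∏_{i<j} (1 + (-1)^i q^{2i+2}) = 1, where B_{2j+1} = ±q^{2j+1} B_{2j+1} forces B_{2j+1} = 0.
-- As Aₘ agrees with the full sum up to qᵐ, letting j → ∞ gives both generating functions. The
-- product identities come from splitting (c q^a; -q^b)_∞ into its factors of even and odd index.

{-# OPTIONS --safe #-}
module Submission where

open import Defs
open import Data.Nat as ℕ
  using (ℕ; zero; suc; _≤_; _<_; z≤n; s≤s; s≤s⁻¹; _∸_; ⌈_/2⌉; ⌊_/2⌋)
import Data.Nat.Properties as ℕP
open import Data.Integer as ℤ using (ℤ; +_; -_; _*_; _+_; _-_; _^_; 0ℤ; 1ℤ; -1ℤ)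
import Data.Integer.Properties as ℤP
open import Data.Integer.Tactic.RingSolver using (solve-∀)
import Data.Nat.Tactic.RingSolver as NS
open import Data.List using (List; []; _∷_; _++_; map; upTo; applyUpTo; foldr; zipWith)
open import Data.List.Properties using (map-cong; ∷-injectiveʳ; ++-identityʳ)
open import Data.List.Membership.Propositional using (_∈_)
open import Data.List.Membership.Propositional.Properties
  using (∈-++⁻; ∈-++⁺ˡ; ∈-++⁺ʳ; ∈-map⁻; ∈-map⁺)
open import Data.List.Relation.Unary.Any using (here)
open import Data.List.Relation.Unary.All using (All; []; _∷_)
open import Data.List.Relation.Unary.AllPairs using ([]; _∷_)
open import Data.List.Relation.Unary.Linked using (Linked; []; [-]; _∷_)
open import Data.List.Relation.Unary.Unique.Propositional using (Unique)
import Data.List.Relation.Unary.Unique.Propositional.Properties as Unique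
open import Data.Nat.ListAction using (sum)
open import Data.Product using (_×_; _,_; proj₁; proj₂)
open import Data.Sum using (inj₁; inj₂)
open import Data.Unit using (⊤; tt)
open import Data.Empty using (⊥-elim)
open import Relation.Nullary using (yes; no; ¬_; Dec)
open import Function using (_∘_)
open import Function.Bundles using (mk⇔)
open import Relation.Binary.PropositionalEquality
open ≡-Reasoning

-- Power series

infixr 25 _·ₛ_
_·ₛ_ : ℤ → Series → Series
(c ·ₛ f) n = c * f n

_≈[_]_ : Series → ℕ → Series → Set
f ≈[ n ] g = ∀ {k} → k ≤ n → f k ≡ g k

≈ₛ⇒≈[] : ∀ {f g} → f ≈ₛ g → ∀ {n} → f ≈[ n ] g
≈ₛ⇒≈[] f≈g _ = f≈g _

sum< : ℕ → (ℕ → ℤ) → ℤ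
sum< zero    f = 0ℤ
sum< (suc n) f = f 0 + sum< n (f ∘ suc)

sumℤ-applyUpTo : ∀ (f : ℕ → ℤ) g n → sumℤ (map f (applyUpTo g n)) ≡ sum< n (f ∘ g)
sumℤ-applyUpTo f g zero    = refl
sumℤ-applyUpTo f g (suc n) = cong (_+_ (f (g 0))) (sumℤ-applyUpTo f (g ∘ suc) n)

*ₛ-as-sum< : ∀ f g n → (f *ₛ g) n ≡ sum< (suc n) (λ k → f k * g (n ∸ k))
*ₛ-as-sum< f g n = sumℤ-applyUpTo (λ k → f k * g (n ∸ k)) (λ k → k) (suc n)

sum<-cong : ∀ {f g} n → (∀ {k} → k < n → f k ≡ g k) → sum< n f ≡ sum< n g
sum<-cong zero    f≡g = refl
sum<-cong (suc n) f≡g = cong₂ _+_ (f≡g (s≤s z≤n)) (sum<-cong n (f≡g ∘ s≤s))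

sum<-zero : ∀ {f} n → (∀ k → f k ≡ 0ℤ) → sum< n f ≡ 0ℤ
sum<-zero zero    f≡0 = refl
sum<-zero (suc n) f≡0 = cong₂ _+_ (f≡0 0) (sum<-zero n (f≡0 ∘ suc))

sum<-linear : ∀ c f g n → sum< n (λ k → f k - c * g k) ≡ sum< n f - c * sum< n g
sum<-linear c f g zero    = sym (cong (_-_ 0ℤ) (ℤP.*-zeroʳ c))
sum<-linear c f g (suc n) = begin
  f 0 - c * g 0 + sum< n (λ k → f (suc k) - c * g (suc k))
    ≡⟨ cong (_+_ (f 0 - c * g 0)) (sum<-linear c (f ∘ suc) (g ∘ suc) n) ⟩
  f 0 - c * g 0 + (sum< n (f ∘ suc) - c * sum< n (g ∘ suc))
    ≡⟨ regroup c (f 0) (g 0) (sum< n (f ∘ suc)) (sum< n (g ∘ suc)) ⟩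
  f 0 + sum< n (f ∘ suc) - c * (g 0 + sum< n (g ∘ suc)) ∎
  where
  regroup : ∀ c a b s t → a - c * b + (s - c * t) ≡ a + s - c * (b + t)
  regroup = solve-∀

*ₛ-local : ∀ {f f' g g' n} → f ≈[ n ] f' → g ≈[ n ] g' → (f *ₛ g) n ≡ (f' *ₛ g') n
*ₛ-local {f} {f'} {g} {g'} {n} f≈f' g≈g' = begin
  (f *ₛ g) n                               ≡⟨ *ₛ-as-sum< f g n ⟩
  sum< (suc n) (λ k → f k * g (n ∸ k))     ≡⟨ sum<-cong (suc n) (λ {k} k<1+n →
    cong₂ _*_ (f≈f' (s≤s⁻¹ k<1+n)) (g≈g' (ℕP.m∸n≤m n k))) ⟩
  sum< (suc n) (λ k → f' k * g' (n ∸ k))   ≡⟨ *ₛ-as-sum< f' g' n ⟨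
  (f' *ₛ g') n                             ∎

*ₛ-localˡ : ∀ {f f'} g n → f ≈[ n ] f' → (f *ₛ g) n ≡ (f' *ₛ g) n
*ₛ-localˡ g n f≈f' = *ₛ-local {g = g} {n = n} f≈f' (λ _ → refl)

*ₛ-cong : ∀ {f f' g g'} → f ≈ₛ f' → g ≈ₛ g' → (f *ₛ g) ≈ₛ (f' *ₛ g')
*ₛ-cong f≈f' g≈g' n = *ₛ-local (≈ₛ⇒≈[] f≈f') (≈ₛ⇒≈[] g≈g')

*ₛ-identityˡ : ∀ g → (oneₛ *ₛ g) ≈ₛ g
*ₛ-identityˡ g n = begin
  (oneₛ *ₛ g) n                                ≡⟨ *ₛ-as-sum< oneₛ g n ⟩
  1ℤ * g n + sum< n (λ k → 0ℤ * g (n ∸ suc k))  ≡⟨ cong (_+_ (1ℤ * g n)) (sum<-zero n (λ _ → refl)) ⟩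
  1ℤ * g n + 0ℤ                                ≡⟨ ℤP.+-identityʳ _ ⟩
  1ℤ * g n                                     ≡⟨ ℤP.*-identityˡ _ ⟩
  g n                                          ∎

*ₛ-linearˡ : ∀ c f f' g →
  ((λ k → f k - c * f' k) *ₛ g) ≈ₛ (λ n → (f *ₛ g) n - c * (f' *ₛ g) n)
*ₛ-linearˡ c f f' g n = begin
  ((λ k → f k - c * f' k) *ₛ g) n
    ≡⟨ *ₛ-as-sum< (λ k → f k - c * f' k) g n ⟩
  sum< (suc n) (λ k → (f k - c * f' k) * g (n ∸ k))
    ≡⟨ sum<-cong (suc n) (λ {k} _ → distrib c (f k) (f' k) (g (n ∸ k))) ⟩
  sum< (suc n) (λ k → f k * g (n ∸ k) - c * (f' k * g (n ∸ k)))
    ≡⟨ sum<-linear c (λ k → f k * g (n ∸ k)) (λ k → f' k * g (n ∸ k)) (suc n) ⟩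
  sum< (suc n) (λ k → f k * g (n ∸ k)) - c * sum< (suc n) (λ k → f' k * g (n ∸ k))
    ≡⟨ cong₂ (λ x y → x - c * y) (*ₛ-as-sum< f g n) (*ₛ-as-sum< f' g n) ⟨
  (f *ₛ g) n - c * (f' *ₛ g) n ∎
  where
  distrib : ∀ c a b x → (a - c * b) * x ≡ a * x - c * (b * x)
  distrib = solve-∀

0ₛ : Series
0ₛ _ = 0ℤ

shift : ℕ → Series → Series
shift zero    g n       = g n
shift (suc e) g zero    = 0ℤ
shift (suc e) g (suc n) = shift e g n

shift-local : ∀ e {g h n} → g ≈[ n ] h → shift e g ≈[ n ] shift e h
shift-local zero    g≈h k≤n = g≈h k≤n
shift-local (suc e) g≈h {zero}  _          = refl
shift-local (suc e) g≈h {suc k} (s≤s k≤n) = shift-local e (g≈h ∘ ℕP.m≤n⇒m≤1+n) k≤n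

shift-cong : ∀ e {g h} → g ≈ₛ h → shift e g ≈ₛ shift e h
shift-cong e g≈h n = shift-local e (≈ₛ⇒≈[] g≈h) ℕP.≤-refl

shift-below : ∀ e g {n} → n < e → shift e g n ≡ 0ℤ
shift-below (suc e) g {zero}  _           = refl
shift-below (suc e) g {suc n} (s≤s n<e) = shift-below e g n<e

shift-at : ∀ e g {n} → e ≤ n → shift e g n ≡ g (n ∸ e)
shift-at zero    g _         = refl
shift-at (suc e) g (s≤s e≤n) = shift-at e g e≤n

shift-+ : ∀ e e' g → shift e (shift e' g) ≈ₛ shift (e ℕ.+ e') g
shift-+ zero    e' g n       = refl
shift-+ (suc e) e' g zero    = refl
shift-+ (suc e) e' g (suc n) = shift-+ e e' g n

shift-comm : ∀ e e' g → shift e (shift e' g) ≈ₛ shift e' (shift e g)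
shift-comm e e' g n = begin
  shift e (shift e' g) n  ≡⟨ shift-+ e e' g n ⟩
  shift (e ℕ.+ e') g n    ≡⟨ cong (λ d → shift d g n) (ℕP.+-comm e e') ⟩
  shift (e' ℕ.+ e) g n    ≡⟨ shift-+ e' e g n ⟨
  shift e' (shift e g) n  ∎

shift-pointwise : ∀ e (F : ℤ → ℤ → ℤ) → F 0ℤ 0ℤ ≡ 0ℤ → ∀ g h →
  shift e (λ k → F (g k) (h k)) ≈ₛ (λ k → F (shift e g k) (shift e h k))
shift-pointwise zero    F F00 g h n       = refl
shift-pointwise (suc e) F F00 g h zero    = sym F00
shift-pointwise (suc e) F F00 g h (suc n) = shift-pointwise e F F00 g h n

shift-scale : ∀ e c g → shift e (c ·ₛ g) ≈ₛ c ·ₛ shift e g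
shift-scale e c g = shift-pointwise e (λ x _ → c * x) (ℤP.*-zeroʳ c) g g

shift-0ₛ : ∀ e → shift e 0ₛ ≈ₛ 0ₛ
shift-0ₛ e = shift-pointwise e (λ _ _ → 0ℤ) refl 0ₛ 0ₛ

shift-*ₛ : ∀ e f h → (shift e f *ₛ h) ≈ₛ shift e (f *ₛ h)
shift-*ₛ zero    f h n       = refl
shift-*ₛ (suc e) f h zero    = refl
shift-*ₛ (suc e) f h (suc n) = begin
  (shift (suc e) f *ₛ h) (suc n)
    ≡⟨ *ₛ-as-sum< (shift (suc e) f) h (suc n) ⟩
  0ℤ * h (suc n) + sum< (suc n) (λ k → shift e f k * h (n ∸ k))
    ≡⟨ ℤP.+-identityˡ _ ⟩
  sum< (suc n) (λ k → shift e f k * h (n ∸ k))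
    ≡⟨ *ₛ-as-sum< (shift e f) h n ⟨
  (shift e f *ₛ h) n
    ≡⟨ shift-*ₛ e f h n ⟩
  shift e (f *ₛ h) n ∎

mono-suc : ∀ c e k → mono c (suc e) (suc k) ≡ mono c e k
mono-suc c e k with e ℕ.≟ k | suc e ℕ.≟ suc k
... | yes _   | yes _   = refl
... | no  _   | no  _   = refl
... | yes e≡k | no  e≢k = ⊥-elim (e≢k (cong suc e≡k))
... | no  e≢k | yes e≡k = ⊥-elim (e≢k (ℕP.suc-injective e≡k))

mono-*ₛ : ∀ c e g → (mono c e *ₛ g) ≈ₛ c ·ₛ shift e g
mono-*ₛ c zero g n = begin
  (mono c 0 *ₛ g) n                                 ≡⟨ *ₛ-as-sum< (mono c 0) g n ⟩
  c * g n + sum< n (λ k → 0ℤ * g (n ∸ suc k))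
                                                    ≡⟨ cong (_+_ (c * g n)) (sum<-zero n (λ _ → refl)) ⟩
  c * g n + 0ℤ                                      ≡⟨ ℤP.+-identityʳ _ ⟩
  c * g n                                           ∎
mono-*ₛ c (suc e) g zero    = sym (ℤP.*-zeroʳ c)
mono-*ₛ c (suc e) g (suc n) = begin
  (mono c (suc e) *ₛ g) (suc n)
    ≡⟨ *ₛ-as-sum< (mono c (suc e)) g (suc n) ⟩
  0ℤ * g (suc n) + sum< (suc n) (λ k → mono c (suc e) (suc k) * g (n ∸ k))
    ≡⟨ ℤP.+-identityˡ _ ⟩
  sum< (suc n) (λ k → mono c (suc e) (suc k) * g (n ∸ k))
    ≡⟨ sum<-cong (suc n) (λ {k} _ → cong (_* g (n ∸ k)) (mono-suc c e k)) ⟩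
  sum< (suc n) (λ k → mono c e k * g (n ∸ k))
    ≡⟨ *ₛ-as-sum< (mono c e) g n ⟨
  (mono c e *ₛ g) n
    ≡⟨ mono-*ₛ c e g n ⟩
  c * shift e g n ∎

-- Products of factors 1 - c qᵉ

-- Series are only ever multiplied by such factors, whose action g ↦ g - c qᵉ g is explicit,
-- so no associativity of the Cauchy product is needed.
mulFactor : ℤ → ℕ → Series → Series
mulFactor c e g n = g n - c * shift e g n

mulFactor-local : ∀ c e {g h n} → g ≈[ n ] h → mulFactor c e g ≈[ n ] mulFactor c e h
mulFactor-local c e g≈h k≤n = cong₂ (λ x y → x - c * y) (g≈h k≤n) (shift-local e g≈h k≤n)

mulFactor-cong : ∀ c e {g h} → g ≈ₛ h → mulFactor c e g ≈ₛ mulFactor c e h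
mulFactor-cong c e g≈h n = mulFactor-local c e (≈ₛ⇒≈[] g≈h) ℕP.≤-refl

mulFactor-below : ∀ c e g {n} → n < e → mulFactor c e g n ≡ g n
mulFactor-below c e g {n} n<e = begin
  g n - c * shift e g n  ≡⟨ cong (λ x → g n - c * x) (shift-below e g n<e) ⟩
  g n - c * 0ℤ           ≡⟨ cong (λ x → g n - x) (ℤP.*-zeroʳ c) ⟩
  g n + 0ℤ               ≡⟨ ℤP.+-identityʳ _ ⟩
  g n                    ∎

*ₛ-factor : ∀ c e g → ((oneₛ -ₛ mono c e) *ₛ g) ≈ₛ mulFactor c e g
*ₛ-factor c e g n = begin
  ((oneₛ -ₛ mono c e) *ₛ g) n
    ≡⟨ *ₛ-localˡ g n (λ {k} _ → cong (_-_ (oneₛ k)) (sym (ℤP.*-identityˡ (mono c e k)))) ⟩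
  ((λ k → oneₛ k - 1ℤ * mono c e k) *ₛ g) n
    ≡⟨ *ₛ-linearˡ 1ℤ oneₛ (mono c e) g n ⟩
  (oneₛ *ₛ g) n - 1ℤ * (mono c e *ₛ g) n
    ≡⟨ cong₂ (λ x y → x - 1ℤ * y) (*ₛ-identityˡ g n) (mono-*ₛ c e g n) ⟩
  g n - 1ℤ * (c * shift e g n)
    ≡⟨ cong (_-_ (g n)) (ℤP.*-identityˡ _) ⟩
  mulFactor c e g n ∎

mulFactor-*ₛ : ∀ c e f h → (mulFactor c e f *ₛ h) ≈ₛ mulFactor c e (f *ₛ h)
mulFactor-*ₛ c e f h n = trans (*ₛ-linearˡ c f (shift e f) h n)
  (cong (λ x → (f *ₛ h) n - c * x) (shift-*ₛ e f h n))

shift-mulFactor : ∀ e c e' g → shift e (mulFactor c e' g) ≈ₛ mulFactor c e' (shift e g)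
shift-mulFactor e c e' g n = begin
  shift e (mulFactor c e' g) n
    ≡⟨ shift-pointwise e (λ x y → x - c * y) (cong (_-_ 0ℤ) (ℤP.*-zeroʳ c)) g (shift e' g) n ⟩
  shift e g n - c * shift e (shift e' g) n
    ≡⟨ cong (λ x → shift e g n - c * x) (shift-comm e e' g n) ⟩
  mulFactor c e' (shift e g) n ∎

mulFactor-comm : ∀ c e c' e' g →
  mulFactor c e (mulFactor c' e' g) ≈ₛ mulFactor c' e' (mulFactor c e g)
mulFactor-comm c e c' e' g n = begin
  g n - c' * shift e' g n - c * shift e (mulFactor c' e' g) n
    ≡⟨ cong (λ x → g n - c' * shift e' g n - c * x) (shift-mulFactor e c' e' g n) ⟩
  g n - c' * shift e' g n - c * (shift e g n - c' * shift e' (shift e g) n)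
    ≡⟨ cong (λ x → g n - c' * shift e' g n - c * (shift e g n - c' * x)) (shift-comm e' e g n) ⟩
  g n - c' * shift e' g n - c * (shift e g n - c' * shift e (shift e' g) n)
    ≡⟨ swap c c' (g n) (shift e g n) (shift e' g n) (shift e (shift e' g) n) ⟩
  g n - c * shift e g n - c' * (shift e' g n - c * shift e (shift e' g) n)
    ≡⟨ cong (λ x → g n - c * shift e g n - c' * x) (shift-mulFactor e' c e g n) ⟨
  mulFactor c' e' (mulFactor c e g) n ∎
  where
  swap : ∀ c c' g a b x → g - c' * b - c * (a - c' * x) ≡ g - c * a - c' * (b - c * x)
  swap = solve-∀

mulFactors : (ℕ → ℤ) → (ℕ → ℕ) → ℕ → Series → Series
mulFactors c e zero    g = g
mulFactors c e (suc j) g = mulFactor (c j) (e j) (mulFactors c e j g)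

mulFactors-local : ∀ c e j {g h n} → g ≈[ n ] h → mulFactors c e j g ≈[ n ] mulFactors c e j h
mulFactors-local c e zero    g≈h = g≈h
mulFactors-local c e (suc j) g≈h = mulFactor-local (c j) (e j) (mulFactors-local c e j g≈h)

mulFactors-cong : ∀ c e j {g h} → g ≈ₛ h → mulFactors c e j g ≈ₛ mulFactors c e j h
mulFactors-cong c e j g≈h n = mulFactors-local c e j (≈ₛ⇒≈[] g≈h) ℕP.≤-refl

mulFactors-congᶜ : ∀ {c c' e e'} → (∀ i → c i ≡ c' i) → (∀ i → e i ≡ e' i) →
  ∀ j g → mulFactors c e j g ≈ₛ mulFactors c' e' j g
mulFactors-congᶜ c≗c' e≗e' zero    g n = refl
mulFactors-congᶜ {c' = c'} {e' = e'} c≗c' e≗e' (suc j) g n rewrite c≗c' j | e≗e' j =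
  mulFactor-cong (c' j) (e' j) (mulFactors-congᶜ c≗c' e≗e' j g) n

mulFactors-mulFactor : ∀ c e j c' e' g →
  mulFactors c e j (mulFactor c' e' g) ≈ₛ mulFactor c' e' (mulFactors c e j g)
mulFactors-mulFactor c e zero    c' e' g n = refl
mulFactors-mulFactor c e (suc j) c' e' g n =
  trans (mulFactor-cong (c j) (e j) (mulFactors-mulFactor c e j c' e' g) n)
        (mulFactor-comm (c j) (e j) c' e' (mulFactors c e j g) n)

mulFactors-front : ∀ c e j g →
  mulFactors c e (suc j) g ≈ₛ mulFactor (c 0) (e 0) (mulFactors (c ∘ suc) (e ∘ suc) j g)
mulFactors-front c e zero    g n = refl
mulFactors-front c e (suc j) g n =
  trans (mulFactor-cong (c (suc j)) (e (suc j)) (mulFactors-front c e j g) n)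
        (mulFactor-comm (c (suc j)) (e (suc j)) (c 0) (e 0) (mulFactors (c ∘ suc) (e ∘ suc) j g) n)

mulFactors-*ₛ : ∀ c e j f h → (mulFactors c e j f *ₛ h) ≈ₛ mulFactors c e j (f *ₛ h)
mulFactors-*ₛ c e zero    f h n = refl
mulFactors-*ₛ c e (suc j) f h n =
  trans (mulFactor-*ₛ (c j) (e j) (mulFactors c e j f) h n)
        (mulFactor-cong (c j) (e j) (mulFactors-*ₛ c e j f h) n)

mulFactors-stable : ∀ c e g → (∀ i → i < e i) →
  ∀ {n j j'} → n ≤ j → j ≤ j' → mulFactors c e j' g n ≡ mulFactors c e j g n
mulFactors-stable c e g i<e {n} {j} n≤j j≤j' = go (ℕP.≤⇒≤′ j≤j')
  where
  go : ∀ {j'} → j ℕ.≤′ j' → mulFactors c e j' g n ≡ mulFactors c e j g n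
  go ℕ.≤′-refl               = refl
  go (ℕ.≤′-step {j'} j≤′j') = trans
    (mulFactor-below (c j') (e j') (mulFactors c e j' g)
      (ℕP.≤-<-trans (ℕP.≤-trans n≤j (ℕP.≤′⇒≤ j≤′j')) (i<e j')))
    (go j≤′j')

-- ∏_{i ≥ 0} (1 - c i q^{e i}), read off as in poch: when e i > i, the factors with i ≥ n do not
-- affect the coefficient of qⁿ.
infProd : (ℕ → ℤ) → (ℕ → ℕ) → Series
infProd c e n = mulFactors c e (suc n) oneₛ n

infProd-congᶜ : ∀ {c c' e e'} → (∀ i → c i ≡ c' i) → (∀ i → e i ≡ e' i) →
  infProd c e ≈ₛ infProd c' e'
infProd-congᶜ c≗c' e≗e' n = mulFactors-congᶜ c≗c' e≗e' (suc n) oneₛ n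

infProd-truncate : ∀ c e → (∀ i → i < e i) →
  ∀ {k j} → k ≤ j → infProd c e k ≡ mulFactors c e j oneₛ k
infProd-truncate c e i<e {k} k≤j = trans
  (mulFactors-stable c e oneₛ i<e ℕP.≤-refl (ℕP.n≤1+n k))
  (sym (mulFactors-stable c e oneₛ i<e ℕP.≤-refl k≤j))

infProd-*ₛ : ∀ c e → (∀ i → i < e i) →
  ∀ h → (infProd c e *ₛ h) ≈ₛ (λ n → mulFactors c e (suc n) h n)
infProd-*ₛ c e i<e h n = begin
  (infProd c e *ₛ h) n
    ≡⟨ *ₛ-localˡ h n (λ k≤n → infProd-truncate c e i<e (ℕP.m≤n⇒m≤1+n k≤n)) ⟩
  (mulFactors c e (suc n) oneₛ *ₛ h) n    ≡⟨ mulFactors-*ₛ c e (suc n) oneₛ h n ⟩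
  mulFactors c e (suc n) (oneₛ *ₛ h) n    ≡⟨ mulFactors-cong c e (suc n) (*ₛ-identityˡ h) n ⟩
  mulFactors c e (suc n) h n              ∎

foldr-factors : ∀ (c : ℕ → ℤ) (e g : ℕ → ℕ) k →
  foldr (λ i acc → (oneₛ -ₛ mono (c i) (e i)) *ₛ acc) oneₛ (applyUpTo g k)
    ≈ₛ mulFactors (c ∘ g) (e ∘ g) k oneₛ
foldr-factors c e g zero    n = refl
foldr-factors c e g (suc k) n = begin
  ((oneₛ -ₛ mono (c (g 0)) (e (g 0))) *ₛ rest) n
    ≡⟨ *ₛ-factor (c (g 0)) (e (g 0)) rest n ⟩
  mulFactor (c (g 0)) (e (g 0)) rest n
    ≡⟨ mulFactor-cong (c (g 0)) (e (g 0)) (foldr-factors c e (g ∘ suc) k) n ⟩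
  mulFactor (c (g 0)) (e (g 0)) (mulFactors (c ∘ g ∘ suc) (e ∘ g ∘ suc) k oneₛ) n
    ≡⟨ mulFactors-front (c ∘ g) (e ∘ g) k oneₛ n ⟨
  mulFactors (c ∘ g) (e ∘ g) (suc k) oneₛ n ∎
  where
  rest = foldr (λ i acc → (oneₛ -ₛ mono (c i) (e i)) *ₛ acc) oneₛ (applyUpTo (g ∘ suc) k)

poch≈infProd : ∀ c a d b → poch c a d b ≈ₛ infProd (λ i → c * d ^ i) (λ i → a ℕ.+ b ℕ.* i)
poch≈infProd c a d b n =
  foldr-factors (λ i → c * d ^ i) (λ i → a ℕ.+ b ℕ.* i) (λ i → i) (suc n) n

i<a+b*i : ∀ {a b} i → 1 ≤ a → 1 ≤ b → i < a ℕ.+ b ℕ.* i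
i<a+b*i {suc a} {suc b} i _ _ = s≤s (ℕP.≤-trans (ℕP.m≤m+n i (b ℕ.* i)) (ℕP.m≤n+m _ a))

-- 2 * j, defined so that double (suc j) reduces to suc (suc (double j)).
double : ℕ → ℕ
double zero    = zero
double (suc j) = suc (suc (double j))

n≤double : ∀ n → n ≤ double n
n≤double zero    = z≤n
n≤double (suc n) = s≤s (ℕP.m≤n⇒m≤1+n (n≤double n))

n≤double[1+n] : ∀ n → n ≤ double (suc n)
n≤double[1+n] n = ℕP.m≤n⇒m≤1+n (ℕP.m≤n⇒m≤1+n (n≤double n))

double≡2* : ∀ n → double n ≡ 2 ℕ.* n
double≡2* zero    = refl
double≡2* (suc n) = trans (cong (suc ∘ suc) (double≡2* n)) (sym (ℕP.*-suc 2 n))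

mulFactors-interleave : ∀ c e j g →
  mulFactors c e (double j) g ≈ₛ
  mulFactors (c ∘ double) (e ∘ double) j (mulFactors (c ∘ suc ∘ double) (e ∘ suc ∘ double) j g)
mulFactors-interleave c e zero    g n = refl
mulFactors-interleave c e (suc j) g n = begin
  L₁ (L₀ (mulFactors c e (double j) g)) n
    ≡⟨ mulFactor-cong c₁ e₁ (mulFactor-cong c₀ e₀ (mulFactors-interleave c e j g)) n ⟩
  L₁ (L₀ (Rₑ (Rₒ g))) n
    ≡⟨ mulFactor-comm c₀ e₀ c₁ e₁ (Rₑ (Rₒ g)) n ⟨
  L₀ (L₁ (Rₑ (Rₒ g))) n
    ≡⟨ mulFactor-cong c₀ e₀ (mulFactors-mulFactor (c ∘ double) (e ∘ double) j c₁ e₁ (Rₒ g)) n ⟨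
  L₀ (Rₑ (L₁ (Rₒ g))) n ∎
  where
  c₀ = c (double j)
  e₀ = e (double j)
  c₁ = c (suc (double j))
  e₁ = e (suc (double j))
  L₀ = mulFactor c₀ e₀
  L₁ = mulFactor c₁ e₁
  Rₑ = mulFactors (c ∘ double) (e ∘ double) j
  Rₒ = mulFactors (c ∘ suc ∘ double) (e ∘ suc ∘ double) j

infProd-split : ∀ c e → (∀ i → i < e i) →
  infProd c e ≈ₛ
  (infProd (c ∘ double) (e ∘ double) *ₛ infProd (c ∘ suc ∘ double) (e ∘ suc ∘ double))
infProd-split c e i<e n = sym (begin
  (infProd cₑ eₑ *ₛ infProd cₒ eₒ) n
    ≡⟨ infProd-*ₛ cₑ eₑ i<eₑ (infProd cₒ eₒ) n ⟩
  mulFactors cₑ eₑ (suc n) (infProd cₒ eₒ) n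
    ≡⟨ mulFactors-local cₑ eₑ (suc n)
         (λ k≤n → infProd-truncate cₒ eₒ i<eₒ (ℕP.m≤n⇒m≤1+n k≤n)) ℕP.≤-refl ⟩
  mulFactors cₑ eₑ (suc n) (mulFactors cₒ eₒ (suc n) oneₛ) n
    ≡⟨ mulFactors-interleave c e (suc n) oneₛ n ⟨
  mulFactors c e (double (suc n)) oneₛ n
    ≡⟨ infProd-truncate c e i<e (n≤double[1+n] n) ⟨
  infProd c e n ∎)
  where
  cₑ = c ∘ double
  eₑ = e ∘ double
  cₒ = c ∘ suc ∘ double
  eₒ = e ∘ suc ∘ double
  i<eₑ : ∀ i → i < eₑ i
  i<eₑ i = ℕP.≤-<-trans (n≤double i) (i<e (double i))
  i<eₒ : ∀ i → i < eₒ i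
  i<eₒ i = ℕP.≤-<-trans (ℕP.m≤n⇒m≤1+n (n≤double i)) (i<e (suc (double i)))

-1^double : ∀ i → -1ℤ ^ double i ≡ 1ℤ
-1^double zero    = refl
-1^double (suc i) = cong (λ x → -1ℤ * (-1ℤ * x)) (-1^double i)

poch-split : ∀ c a b → 1 ≤ a → 1 ≤ b →
  poch c a -1ℤ b ≈ₛ (poch c a 1ℤ (2 ℕ.* b) *ₛ poch (- c) (a ℕ.+ b) 1ℤ (2 ℕ.* b))
poch-split c a b 1≤a 1≤b n = begin
  poch c a -1ℤ b n
    ≡⟨ poch≈infProd c a -1ℤ b n ⟩
  infProd (λ i → c * -1ℤ ^ i) (λ i → a ℕ.+ b ℕ.* i) n
    ≡⟨ infProd-split _ _ (λ i → i<a+b*i i 1≤a 1≤b) n ⟩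
  (infProd (λ i → c * -1ℤ ^ double i) (λ i → a ℕ.+ b ℕ.* double i) *ₛ
   infProd (λ i → c * -1ℤ ^ suc (double i)) (λ i → a ℕ.+ b ℕ.* suc (double i))) n
    ≡⟨ *ₛ-cong (infProd-congᶜ even-coeff even-exp) (infProd-congᶜ odd-coeff odd-exp) n ⟩
  (infProd (λ i → c * 1ℤ ^ i) (λ i → a ℕ.+ 2 ℕ.* b ℕ.* i) *ₛ
   infProd (λ i → - c * 1ℤ ^ i) (λ i → a ℕ.+ b ℕ.+ 2 ℕ.* b ℕ.* i)) n
    ≡⟨ *ₛ-cong (poch≈infProd c a 1ℤ (2 ℕ.* b))
               (poch≈infProd (- c) (a ℕ.+ b) 1ℤ (2 ℕ.* b)) n ⟨
  (poch c a 1ℤ (2 ℕ.* b) *ₛ poch (- c) (a ℕ.+ b) 1ℤ (2 ℕ.* b)) n ∎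
  where
  even-power : ∀ i → -1ℤ ^ double i ≡ 1ℤ ^ i
  even-power i = trans (-1^double i) (sym (ℤP.^-zeroˡ i))
  even-coeff : ∀ i → c * -1ℤ ^ double i ≡ c * 1ℤ ^ i
  even-coeff i = cong (c *_) (even-power i)
  odd-coeff : ∀ i → c * -1ℤ ^ suc (double i) ≡ - c * 1ℤ ^ i
  odd-coeff i = begin
    c * (-1ℤ * -1ℤ ^ double i)  ≡⟨ cong (λ x → c * (-1ℤ * x)) (even-power i) ⟩
    c * (-1ℤ * 1ℤ ^ i)          ≡⟨ negate-swap c (1ℤ ^ i) ⟩
    - c * 1ℤ ^ i                ∎
    where
    negate-swap : ∀ c x → c * (-1ℤ * x) ≡ - c * x
    negate-swap = solve-∀
  even-exp : ∀ i → a ℕ.+ b ℕ.* double i ≡ a ℕ.+ 2 ℕ.* b ℕ.* i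
  even-exp i = cong (a ℕ.+_) (trans (cong (b ℕ.*_) (double≡2* i)) (reassoc b i))
    where
    reassoc : ∀ b i → b ℕ.* (2 ℕ.* i) ≡ 2 ℕ.* b ℕ.* i
    reassoc = NS.solve-∀
  odd-exp : ∀ i → a ℕ.+ b ℕ.* suc (double i) ≡ a ℕ.+ b ℕ.+ 2 ℕ.* b ℕ.* i
  odd-exp i = trans (cong (λ d → a ℕ.+ b ℕ.* suc d) (double≡2* i)) (reassoc a b i)
    where
    reassoc : ∀ a b i → a ℕ.+ b ℕ.* suc (2 ℕ.* i) ≡ a ℕ.+ b ℕ.+ 2 ℕ.* b ℕ.* i
    reassoc = NS.solve-∀

-- Multiplicative inverses

reversedPrefix : Series → ℕ → List ℤ
reversedPrefix g zero    = g 0 ∷ []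
reversedPrefix g (suc n) = g (suc n) ∷ reversedPrefix g n

sumℤ-zipWith-reversedPrefix : ∀ g (h : ℕ → ℤ) t n →
  sumℤ (zipWith _*_ (map h (applyUpTo t (suc n))) (reversedPrefix g n))
    ≡ sum< (suc n) (λ k → h (t k) * g (n ∸ k))
sumℤ-zipWith-reversedPrefix g h t zero    = refl
sumℤ-zipWith-reversedPrefix g h t (suc n) =
  cong (_+_ (h (t 0) * g (suc n))) (sumℤ-zipWith-reversedPrefix g h (t ∘ suc) n)

invRev≡reversedPrefix : ∀ f g → f 0 ≡ 1ℤ → (f *ₛ g) ≈ₛ oneₛ →
  ∀ n → invRev f n ≡ reversedPrefix g n
invRev≡reversedPrefix f g f0≡1 fg≈1 zero = cong (_∷ []) (begin
  1ℤ                   ≡⟨ fg≈1 0 ⟨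
  f 0 * g 0 + 0ℤ       ≡⟨ cong (λ x → x * g 0 + 0ℤ) f0≡1 ⟩
  1ℤ * g 0 + 0ℤ        ≡⟨ ℤP.+-identityʳ _ ⟩
  1ℤ * g 0             ≡⟨ ℤP.*-identityˡ _ ⟩
  g 0                  ∎)
invRev≡reversedPrefix f g f0≡1 fg≈1 (suc n) rewrite invRev≡reversedPrefix f g f0≡1 fg≈1 n =
  cong (_∷ reversedPrefix g n) (begin
    - sumℤ (zipWith _*_ (map (f ∘ suc) (upTo (suc n))) (reversedPrefix g n))
      ≡⟨ cong -_ (sumℤ-zipWith-reversedPrefix g (f ∘ suc) (λ k → k) n) ⟩
    - rest                                ≡⟨ solve-for-g (g (suc n)) rest ⟩
    g (suc n) - (1ℤ * g (suc n) + rest)   ≡⟨ cong (λ x → g (suc n) - (x * g (suc n) + rest)) f0≡1 ⟨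
    g (suc n) - (f 0 * g (suc n) + rest)  ≡⟨ cong (_-_ (g (suc n))) (*ₛ-as-sum< f g (suc n)) ⟨
    g (suc n) - (f *ₛ g) (suc n)          ≡⟨ cong (_-_ (g (suc n))) (fg≈1 (suc n)) ⟩
    g (suc n) - 0ℤ                        ≡⟨ ℤP.+-identityʳ _ ⟩
    g (suc n)                             ∎)
  where
  rest = sum< (suc n) (λ k → f (suc k) * g (n ∸ k))
  solve-for-g : ∀ x r → - r ≡ x - (1ℤ * x + r)
  solve-for-g = solve-∀

invₛ-unique : ∀ f g → f 0 ≡ 1ℤ → (f *ₛ g) ≈ₛ oneₛ → invₛ f ≈ₛ g
invₛ-unique f g f0≡1 fg≈1 n with invRev f n | invRev≡reversedPrefix f g f0≡1 fg≈1 n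
invₛ-unique f g f0≡1 fg≈1 zero    | _ | refl = refl
invₛ-unique f g f0≡1 fg≈1 (suc n) | _ | refl = refl

invRev-cong : ∀ {f g} → f ≈ₛ g → ∀ n → invRev f n ≡ invRev g n
invRev-cong f≈g zero    = refl
invRev-cong f≈g (suc n) = cong₂ (λ fs bs → - sumℤ (zipWith _*_ fs bs) ∷ bs)
  (map-cong (f≈g ∘ suc) (upTo (suc n))) (invRev-cong f≈g n)

invₛ-cong : ∀ {f g} → f ≈ₛ g → invₛ f ≈ₛ invₛ g
invₛ-cong {f} {g} f≈g n with invRev f n | invRev g n | invRev-cong f≈g n
... | [] | _ | refl = refl
... | _ ∷ _ | _ | refl = refl

-- Chains with bounded largest part

ℰ : List ℕ → ℕ
ℰ π = sum (evenParts π)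

-- weight (x ∷ π) reduces to weight′ π.

weight′ : List ℕ → ℤ
weight′ π = -1ℤ ^ sum (map ⌈_/2⌉ (oddParts π))

sgn : ℕ → ℤ
sgn x = -1ℤ ^ ⌈ x /2⌉

weight′-∷ : ∀ x π → weight′ (x ∷ π) ≡ sgn x * weight π
weight′-∷ x π = ℤP.^-distribˡ-+-* -1ℤ ⌈ x /2⌉ _

sumℤ-map-++ : ∀ {A : Set} (w : A → ℤ) xs ys →
  sumℤ (map w (xs ++ ys)) ≡ sumℤ (map w xs) + sumℤ (map w ys)
sumℤ-map-++ w []       ys = sym (ℤP.+-identityˡ _)
sumℤ-map-++ w (x ∷ xs) ys =
  trans (cong (_+_ (w x)) (sumℤ-map-++ w xs ys)) (sym (ℤP.+-assoc (w x) _ _))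

sumℤ-weight-∷ : ∀ x πs → sumℤ (map weight (map (x ∷_) πs)) ≡ sumℤ (map weight′ πs)
sumℤ-weight-∷ x []       = refl
sumℤ-weight-∷ x (π ∷ πs) = cong (_+_ (weight′ π)) (sumℤ-weight-∷ x πs)

sumℤ-weight′-∷ : ∀ x πs →
  sumℤ (map weight′ (map (x ∷_) πs)) ≡ sgn x * sumℤ (map weight πs)
sumℤ-weight′-∷ x []       = sym (ℤP.*-zeroʳ (sgn x))
sumℤ-weight′-∷ x (π ∷ πs) = trans (cong₂ _+_ (weight′-∷ x π) (sumℤ-weight′-∷ x πs))
  (sym (ℤP.*-distribˡ-+ (sgn x) (weight π) _))

when : ∀ {P A : Set} → Dec P → List A → List A
when (yes _) xs = xs
when (no _)  _  = []

when-∈⁻ : ∀ {P A : Set} (d : Dec P) {xs} {x : A} → x ∈ when d xs → P × x ∈ xs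
when-∈⁻ (yes p) x∈ = p , x∈

when-∈⁺ : ∀ {P A : Set} (d : Dec P) {xs} {x : A} → P → x ∈ xs → x ∈ when d xs
when-∈⁺ (yes _) _ x∈ = x∈
when-∈⁺ (no ¬p) p _  = ⊥-elim (¬p p)

when-unique : ∀ {P A : Set} (d : Dec P) {xs : List A} → Unique xs → Unique (when d xs)
when-unique (yes _) u = u
when-unique (no _)  _ = []

emptyChain : ℕ → List (List ℕ)
emptyChain n = when (n ℕ.≟ 0) ([] ∷ [])

emptyChain-unique : ∀ n → Unique (emptyChain n)
emptyChain-unique n = when-unique (n ℕ.≟ 0) ([] ∷ [])

HeadAtMost : ℕ → List ℕ → Set
HeadAtMost m []      = ⊤
HeadAtMost m (x ∷ _) = x ≤ m

HeadAtMost-suc : ∀ {m π} → HeadAtMost m π → HeadAtMost (suc m) π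
HeadAtMost-suc {π = []}    _   = tt
HeadAtMost-suc {π = _ ∷ _} x≤m = ℕP.m≤n⇒m≤1+n x≤m

HeadAtMost-𝒪 : ∀ π → HeadAtMost (𝒪 π) π
HeadAtMost-𝒪 []      = tt
HeadAtMost-𝒪 (x ∷ π) = ℕP.m≤m+n x (ℰ π)

++-map-∷-unique : ∀ {m} {old new : List (List ℕ)} → Unique old → Unique new →
  (∀ {π} → π ∈ old → HeadAtMost m π) → Unique (old ++ map (suc m ∷_) new)
++-map-∷-unique {m} uold unew bound = Unique.++⁺ uold (Unique.map⁺ ∷-injectiveʳ unew) disjoint
  where
  disjoint : ∀ {π} → ¬ (π ∈ _ × π ∈ map (suc m ∷_) _)
  disjoint (π∈old , π∈new) with ∈-map⁻ (suc m ∷_) π∈new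
  ... | _ , _ , refl = ℕP.<-irrefl refl (bound π∈old)

-- Chains are lists of positive parts, consecutive ones related by ≺, where suc m ≺ y ⇔ y ≤ cap m:
-- distinct parts (≺ is >, cap m = m) or partitions (≺ is ≥, cap m = suc m). 𝒪-chains f n m lists
-- the chains with largest part at most m and 𝒪 = n, ℰ-chains f n m those with ℰ = n. The fuel f
-- only ensures termination; it is sufficient once n ≤ f.
module Chains {_≺_ : ℕ → ℕ → Set} (cap : ℕ → ℕ)
  (≺⇒≤cap : ∀ {m y} → suc m ≺ y → y ≤ cap m)
  (≤cap⇒≺ : ∀ {m y} → y ≤ cap m → suc m ≺ y) where

  IsChain : List ℕ → Set
  IsChain π = Linked _≺_ π × All (0 <_) π

  Chain : (List ℕ → ℕ) → ℕ → ℕ → List ℕ → Set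
  Chain stat n m π = IsChain π × HeadAtMost m π × stat π ≡ n

  ∷-chain : ∀ {m π} → IsChain π → HeadAtMost (cap m) π → IsChain (suc m ∷ π)
  ∷-chain {π = []}    _        _   = [-] , s≤s z≤n ∷ []
  ∷-chain {π = y ∷ π} (l , ps) y≤c = ≤cap⇒≺ y≤c ∷ l , s≤s z≤n ∷ ps

  tail-Chain : ∀ stat {n m π} → IsChain (suc m ∷ π) → stat π ≡ n → Chain stat n (cap m) π
  tail-Chain stat {π = []}    (_ , _ ∷ ps)       stat≡n = ([] , ps) , tt , stat≡n
  tail-Chain stat {π = y ∷ π} (m≺y ∷ l , _ ∷ ps) stat≡n = (l , ps) , ≺⇒≤cap m≺y , stat≡n

  mutual
    𝒪-chains : ℕ → ℕ → ℕ → List (List ℕ)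
    𝒪-chains zero    n _       = emptyChain n
    𝒪-chains (suc f) n zero    = emptyChain n
    𝒪-chains (suc f) n (suc m) =
      𝒪-chains (suc f) n m
        ++ map (suc m ∷_) (when (suc m ℕ.≤? n) (ℰ-chains f (n ∸ suc m) (cap m)))

    ℰ-chains : ℕ → ℕ → ℕ → List (List ℕ)
    ℰ-chains f n zero    = emptyChain n
    ℰ-chains f n (suc m) = ℰ-chains f n m ++ map (suc m ∷_) (𝒪-chains f n (cap m))

  emptyChain-sound : ∀ stat {n m π} → stat [] ≡ 0 → π ∈ emptyChain n → Chain stat n m π
  emptyChain-sound stat {n = zero} stat[]≡0 (here refl) = ([] , []) , tt , stat[]≡0

  Chain-suc : ∀ {stat n m π} → Chain stat n m π → Chain stat n (suc m) π
  Chain-suc {π = π} (c , h , s) = c , HeadAtMost-suc {π = π} h , s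

  mutual
    𝒪-chains-sound : ∀ f n m {π} → π ∈ 𝒪-chains f n m → Chain 𝒪 n m π
    𝒪-chains-sound zero    n m       π∈ = emptyChain-sound 𝒪 refl π∈
    𝒪-chains-sound (suc f) n zero    π∈ = emptyChain-sound 𝒪 refl π∈
    𝒪-chains-sound (suc f) n (suc m) π∈ with ∈-++⁻ (𝒪-chains (suc f) n m) π∈
    ... | inj₁ π∈old = Chain-suc {stat = 𝒪} (𝒪-chains-sound (suc f) n m π∈old)
    ... | inj₂ π∈new with ∈-map⁻ (suc m ∷_) π∈new
    ... | π , π∈when , refl with when-∈⁻ (suc m ℕ.≤? n) π∈when
    ... | m<n , π∈ with ℰ-chains-sound f (n ∸ suc m) (cap m) π∈
    ... | c , h , ℰπ≡ =
      ∷-chain c h , ℕP.≤-refl , trans (cong (suc m ℕ.+_) ℰπ≡) (ℕP.m+[n∸m]≡n m<n)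

    ℰ-chains-sound : ∀ f n m {π} → π ∈ ℰ-chains f n m → Chain ℰ n m π
    ℰ-chains-sound f n zero    π∈ = emptyChain-sound ℰ refl π∈
    ℰ-chains-sound f n (suc m) π∈ with ∈-++⁻ (ℰ-chains f n m) π∈
    ... | inj₁ π∈old = Chain-suc {stat = ℰ} (ℰ-chains-sound f n m π∈old)
    ... | inj₂ π∈new with ∈-map⁻ (suc m ∷_) π∈new
    ... | π , π∈ , refl with 𝒪-chains-sound f n (cap m) π∈
    ... | c , h , 𝒪π≡ = ∷-chain c h , ℕP.≤-refl , 𝒪π≡

  []∈𝒪-chains : ∀ f m → [] ∈ 𝒪-chains f 0 m
  []∈𝒪-chains zero    m       = here refl
  []∈𝒪-chains (suc f) zero    = here refl
  []∈𝒪-chains (suc f) (suc m) = ∈-++⁺ˡ ([]∈𝒪-chains (suc f) m)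

  []∈ℰ-chains : ∀ f m → [] ∈ ℰ-chains f 0 m
  []∈ℰ-chains f zero    = here refl
  []∈ℰ-chains f (suc m) = ∈-++⁺ˡ ([]∈ℰ-chains f m)

  Complete : (List ℕ → ℕ) → (ℕ → ℕ → List (List ℕ)) → ℕ → Set
  Complete stat chains f = ∀ n m π → n ≤ f → Chain stat n m π → π ∈ chains n m

  ℰ-chains-complete : ∀ f → Complete 𝒪 (𝒪-chains f) f → Complete ℰ (ℰ-chains f) f
  ℰ-chains-complete f 𝒪-complete n m       []      _   (_ , _ , refl)            = []∈ℰ-chains f m
  ℰ-chains-complete f 𝒪-complete n zero    (x ∷ π) _   ((_ , 0<x ∷ _) , x≤0 , _) =
    ⊥-elim (ℕP.<⇒≱ 0<x x≤0)
  ℰ-chains-complete f 𝒪-complete n (suc m) (x ∷ π) n≤f (c , x≤1+m , ℰ≡n) with x ℕ.≟ suc m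
  ... | no x≢1+m = ∈-++⁺ˡ (ℰ-chains-complete f 𝒪-complete n m (x ∷ π) n≤f
                     (c , s≤s⁻¹ (ℕP.≤∧≢⇒< x≤1+m x≢1+m) , ℰ≡n))
  ... | yes refl = ∈-++⁺ʳ (ℰ-chains f n m) (∈-map⁺ (suc m ∷_)
                     (𝒪-complete n (cap m) π n≤f (tail-Chain 𝒪 c ℰ≡n)))

  𝒪-chains-suc-complete : ∀ f → Complete ℰ (ℰ-chains f) f → Complete 𝒪 (𝒪-chains (suc f)) (suc f)
  𝒪-chains-suc-complete f ℰ-complete n m       []      _ (_ , _ , refl)            = []∈𝒪-chains (suc f) m
  𝒪-chains-suc-complete f ℰ-complete n zero    (x ∷ π) _ ((_ , 0<x ∷ _) , x≤0 , _) =
    ⊥-elim (ℕP.<⇒≱ 0<x x≤0)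
  𝒪-chains-suc-complete f ℰ-complete n (suc m) (x ∷ π) n≤1+f (c , x≤1+m , 𝒪≡n) with x ℕ.≟ suc m
  ... | no x≢1+m = ∈-++⁺ˡ (𝒪-chains-suc-complete f ℰ-complete n m (x ∷ π) n≤1+f
                     (c , s≤s⁻¹ (ℕP.≤∧≢⇒< x≤1+m x≢1+m) , 𝒪≡n))
  ... | yes refl = ∈-++⁺ʳ (𝒪-chains (suc f) n m) (∈-map⁺ (suc m ∷_) (when-∈⁺ (suc m ℕ.≤? n)
                     (ℕP.≤-trans (ℕP.m≤m+n (suc m) (ℰ π)) (ℕP.≤-reflexive 𝒪≡n))
                     (ℰ-complete (n ∸ suc m) (cap m) π
                       (ℕP.≤-trans (ℕP.∸-monoˡ-≤ (suc m) n≤1+f) (ℕP.m∸n≤m f m))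
                       (tail-Chain ℰ c
                         (trans (sym (ℕP.m+n∸m≡n (suc m) (ℰ π))) (cong (_∸ suc m) 𝒪≡n))))))

  𝒪-chains-complete : ∀ f → Complete 𝒪 (𝒪-chains f) f
  𝒪-chains-complete zero    n m []      _   (_ , _ , refl)            = []∈𝒪-chains zero m
  𝒪-chains-complete zero    n m (x ∷ π) n≤0 ((_ , 0<x ∷ _) , _ , refl) =
    ⊥-elim (ℕP.<⇒≱ 0<x (ℕP.≤-trans (ℕP.m≤m+n x (ℰ π)) n≤0))
  𝒪-chains-complete (suc f) = 𝒪-chains-suc-complete f (ℰ-chains-complete f (𝒪-chains-complete f))

  mutual
    𝒪-chains-unique : ∀ f n m → Unique (𝒪-chains f n m)
    𝒪-chains-unique zero    n _       = emptyChain-unique n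
    𝒪-chains-unique (suc f) n zero    = emptyChain-unique n
    𝒪-chains-unique (suc f) n (suc m) = ++-map-∷-unique (𝒪-chains-unique (suc f) n m)
      (when-unique (suc m ℕ.≤? n) (ℰ-chains-unique f (n ∸ suc m) (cap m)))
      (proj₁ ∘ proj₂ ∘ 𝒪-chains-sound (suc f) n m)

    ℰ-chains-unique : ∀ f n m → Unique (ℰ-chains f n m)
    ℰ-chains-unique f n zero    = emptyChain-unique n
    ℰ-chains-unique f n (suc m) = ++-map-∷-unique (ℰ-chains-unique f n m) (𝒪-chains-unique f n (cap m))
      (proj₁ ∘ proj₂ ∘ ℰ-chains-sound f n m)

  𝒪-chains-1-0 : ∀ m → 𝒪-chains 1 0 m ≡ emptyChain 0
  𝒪-chains-1-0 zero    = refl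
  𝒪-chains-1-0 (suc m) = trans (++-identityʳ _) (𝒪-chains-1-0 m)

  mutual
    𝒪-chains-fuel : ∀ f n m → n ≤ f → 𝒪-chains (suc f) n m ≡ 𝒪-chains f n m
    𝒪-chains-fuel zero    zero m       z≤n = 𝒪-chains-1-0 m
    𝒪-chains-fuel (suc f) n    zero    _   = refl
    𝒪-chains-fuel (suc f) n    (suc m) n≤f = cong₂ _++_ (𝒪-chains-fuel (suc f) n m n≤f)
      (cong (map (suc m ∷_) ∘ when (suc m ℕ.≤? n))
        (ℰ-chains-fuel f (n ∸ suc m) (cap m) (ℕP.≤-trans (ℕP.∸-monoˡ-≤ (suc m) n≤f) (ℕP.m∸n≤m f m))))

    ℰ-chains-fuel : ∀ f n m → n ≤ f → ℰ-chains (suc f) n m ≡ ℰ-chains f n m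
    ℰ-chains-fuel f n zero    _   = refl
    ℰ-chains-fuel f n (suc m) n≤f =
      cong₂ _++_ (ℰ-chains-fuel f n m n≤f) (cong (map (suc m ∷_)) (𝒪-chains-fuel f n (cap m) n≤f))

  ℰ-chains-canonical : ∀ {f n} m → n ≤ f → ℰ-chains f n m ≡ ℰ-chains n n m
  ℰ-chains-canonical {n = n} m n≤f = go (ℕP.≤⇒≤′ n≤f)
    where
    go : ∀ {f} → n ℕ.≤′ f → ℰ-chains f n m ≡ ℰ-chains n n m
    go ℕ.≤′-refl             = refl
    go (ℕ.≤′-step n≤′f) = trans (ℰ-chains-fuel _ n m (ℕP.≤′⇒≤ n≤′f)) (go n≤′f)

  𝒪-series ℰ-series : ℕ → Series
  𝒪-series m n = sumℤ (map weight (𝒪-chains n n m))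
  ℰ-series m n = sumℤ (map weight′ (ℰ-chains n n m))

  𝒪-limit : Series
  𝒪-limit n = 𝒪-series n n

  𝒪-series-zero : 𝒪-series 0 ≈ₛ oneₛ
  𝒪-series-zero zero    = refl
  𝒪-series-zero (suc n) = refl

  ℰ-series-zero : ℰ-series 0 ≈ₛ oneₛ
  ℰ-series-zero zero    = refl
  ℰ-series-zero (suc n) = refl

  𝒪-series-suc : ∀ m →
    𝒪-series (suc m) ≈ₛ (λ n → 𝒪-series m n + shift (suc m) (ℰ-series (cap m)) n)
  𝒪-series-suc m zero    = refl
  𝒪-series-suc m (suc f) = begin
    𝒪-series (suc m) (suc f)
      ≡⟨ sumℤ-map-++ weight (𝒪-chains (suc f) (suc f) m) (map (suc m ∷_) new) ⟩
    𝒪-series m (suc f) + sumℤ (map weight (map (suc m ∷_) new))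
      ≡⟨ cong (_+_ (𝒪-series m (suc f))) (sumℤ-weight-∷ (suc m) new) ⟩
    𝒪-series m (suc f) + sumℤ (map weight′ new)
      ≡⟨ cong (_+_ (𝒪-series m (suc f))) (new-sum (suc m ℕ.≤? suc f)) ⟩
    𝒪-series m (suc f) + shift (suc m) (ℰ-series (cap m)) (suc f) ∎
    where
    new = when (suc m ℕ.≤? suc f) (ℰ-chains f (f ∸ m) (cap m))
    new-sum : (d : Dec (suc m ≤ suc f)) →
      sumℤ (map weight′ (when d (ℰ-chains f (f ∸ m) (cap m))))
        ≡ shift (suc m) (ℰ-series (cap m)) (suc f)
    new-sum (yes m<n) = trans (cong (sumℤ ∘ map weight′) (ℰ-chains-canonical (cap m) (ℕP.m∸n≤m f m)))
                              (sym (shift-at (suc m) (ℰ-series (cap m)) m<n))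
    new-sum (no m≮n)  = sym (shift-below (suc m) (ℰ-series (cap m)) (ℕP.≰⇒> m≮n))

  ℰ-series-suc : ∀ m →
    ℰ-series (suc m) ≈ₛ (λ n → ℰ-series m n + sgn (suc m) * 𝒪-series (cap m) n)
  ℰ-series-suc m n = trans (sumℤ-map-++ weight′ (ℰ-chains n n m) _)
    (cong (_+_ (ℰ-series m n)) (sumℤ-weight′-∷ (suc m) (𝒪-chains n n (cap m))))

  𝒪-series-stable : ∀ {m n} → n ≤ m → 𝒪-series m n ≡ 𝒪-series n n
  𝒪-series-stable {n = n} n≤m = go (ℕP.≤⇒≤′ n≤m)
    where
    go : ∀ {m} → n ℕ.≤′ m → 𝒪-series m n ≡ 𝒪-series n n
    go ℕ.≤′-refl              = refl
    go (ℕ.≤′-step {m} n≤′m) = begin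
      𝒪-series (suc m) n                                     ≡⟨ 𝒪-series-suc m n ⟩
      𝒪-series m n + shift (suc m) (ℰ-series (cap m)) n      ≡⟨ cong (_+_ (𝒪-series m n))
        (shift-below (suc m) (ℰ-series (cap m)) (s≤s (ℕP.≤′⇒≤ n≤′m))) ⟩
      𝒪-series m n + 0ℤ                                      ≡⟨ ℤP.+-identityʳ _ ⟩
      𝒪-series m n                                           ≡⟨ go n≤′m ⟩
      𝒪-series n n                                           ∎

  hasCoeff : ∀ n → HasCoeff IsChain n (𝒪-limit n)
  hasCoeff n = 𝒪-chains n n n , 𝒪-chains-unique n n n ,
    (λ π → mk⇔ (λ π∈ → let c , _ , 𝒪π≡n = 𝒪-chains-sound n n n π∈ in c , 𝒪π≡n)
               (λ (c , 𝒪π≡n) → 𝒪-chains-complete n n n π ℕP.≤-refl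
                  (c , subst (λ k → HeadAtMost k π) 𝒪π≡n (HeadAtMost-𝒪 π) , 𝒪π≡n))) ,
    refl

-- Closed forms

shift-fixed⇒0 : ∀ c e h → (∀ n → h n ≡ c * shift (suc e) h n) → h ≈ₛ 0ₛ
shift-fixed⇒0 c e h h≡ n = vanishes n ℕP.≤-refl
  where
  vanishes : ∀ n → h ≈[ n ] 0ₛ
  vanishes n       {zero}  _         = trans (h≡ 0) (ℤP.*-zeroʳ c)
  vanishes (suc n) {suc k} (s≤s k≤n) = begin
    h (suc k)                  ≡⟨ h≡ (suc k) ⟩
    c * shift e h k            ≡⟨ cong (c *_) (shift-local e (vanishes n) k≤n) ⟩
    c * shift e 0ₛ k           ≡⟨ cong (c *_) (shift-0ₛ e k) ⟩
    c * 0ℤ                     ≡⟨ ℤP.*-zeroʳ c ⟩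
    0ℤ                         ∎

⌊double/2⌋ : ∀ j → ⌊ double j /2⌋ ≡ j
⌊double/2⌋ zero    = refl
⌊double/2⌋ (suc j) = cong suc (⌊double/2⌋ j)

⌈double/2⌉ : ∀ j → ⌈ double j /2⌉ ≡ j
⌈double/2⌉ zero    = refl
⌈double/2⌉ (suc j) = cong suc (⌈double/2⌉ j)

sgn-odd : ∀ j → sgn (suc (double j)) ≡ -1ℤ ^ suc j
sgn-odd j = cong (λ k → -1ℤ ^ suc k) (⌊double/2⌋ j)

sgn-even : ∀ j → sgn (double (suc j)) ≡ -1ℤ ^ suc j
sgn-even j = cong (-1ℤ ^_) (⌈double/2⌉ (suc j))

altSign : ℕ → ℤ
altSign i = -1ℤ * -1ℤ ^ i

module Distinct = Chains {_≺_ = ℕ._>_} (λ m → m) s≤s⁻¹ s≤s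

distinct-closed : ∀ j →
  Distinct.𝒪-series (double j) ≈ₛ mulFactors altSign (λ i → 1 ℕ.+ 2 ℕ.* i) j oneₛ ×
  Distinct.ℰ-series (double j) ≈ₛ (-1ℤ ^ j) ·ₛ mulFactors altSign (λ i → 1 ℕ.+ 2 ℕ.* i) j oneₛ
distinct-closed zero    = 𝒪-series-zero , λ n → trans (ℰ-series-zero n) (sym (ℤP.*-identityˡ _))
  where open Distinct
distinct-closed (suc j) = 𝒪-even , ℰ-even
  where
  open Distinct
  c = altSign
  e : ℕ → ℕ
  e i = 1 ℕ.+ 2 ℕ.* i
  P = mulFactors c e
  s = -1ℤ ^ j
  m = double j
  𝒪-odd : 𝒪-series (suc m) ≈ₛ P (suc j) oneₛ
  𝒪-odd n = begin
    𝒪-series (suc m) n                         ≡⟨ 𝒪-series-suc m n ⟩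
    𝒪-series m n + shift (suc m) (ℰ-series m) n
      ≡⟨ cong₂ _+_ (proj₁ (distinct-closed j) n) (shift-cong (suc m) (proj₂ (distinct-closed j)) n) ⟩
    P j oneₛ n + shift (suc m) (s ·ₛ P j oneₛ) n
      ≡⟨ cong (_+_ (P j oneₛ n)) (shift-scale (suc m) s (P j oneₛ) n) ⟩
    P j oneₛ n + s * shift (suc m) (P j oneₛ) n
      ≡⟨ flip-sign (P j oneₛ n) s _ ⟩
    P j oneₛ n - c j * shift (suc m) (P j oneₛ) n
      ≡⟨ cong (λ d → P j oneₛ n - c j * shift d (P j oneₛ) n) (cong suc (double≡2* j)) ⟩
    P (suc j) oneₛ n                           ∎
    where
    flip-sign : ∀ a s x → a + s * x ≡ a - -1ℤ * s * x
    flip-sign = solve-∀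
  ℰ-odd : ℰ-series (suc m) ≈ₛ 0ₛ
  ℰ-odd n = begin
    ℰ-series (suc m) n                              ≡⟨ ℰ-series-suc m n ⟩
    ℰ-series m n + sgn (suc m) * 𝒪-series m n
      ≡⟨ cong₂ _+_ (proj₂ (distinct-closed j) n) (cong₂ _*_ (sgn-odd j) (proj₁ (distinct-closed j) n)) ⟩
    s * P j oneₛ n + -1ℤ * s * P j oneₛ n         ≡⟨ cancel s (P j oneₛ n) ⟩
    0ℤ                                            ∎
    where
    cancel : ∀ s x → s * x + -1ℤ * s * x ≡ 0ℤ
    cancel = solve-∀
  𝒪-even : 𝒪-series (suc (suc m)) ≈ₛ P (suc j) oneₛ
  𝒪-even n = begin
    𝒪-series (suc (suc m)) n                               ≡⟨ 𝒪-series-suc (suc m) n ⟩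
    𝒪-series (suc m) n + shift (suc (suc m)) (ℰ-series (suc m)) n
      ≡⟨ cong₂ _+_ (𝒪-odd n) (trans (shift-cong (suc (suc m)) ℰ-odd n) (shift-0ₛ (suc (suc m)) n)) ⟩
    P (suc j) oneₛ n + 0ℤ                                  ≡⟨ ℤP.+-identityʳ _ ⟩
    P (suc j) oneₛ n                                       ∎
  ℰ-even : ℰ-series (suc (suc m)) ≈ₛ (-1ℤ ^ suc j) ·ₛ P (suc j) oneₛ
  ℰ-even n = begin
    ℰ-series (suc (suc m)) n                                  ≡⟨ ℰ-series-suc (suc m) n ⟩
    ℰ-series (suc m) n + sgn (suc (suc m)) * 𝒪-series (suc m) n
      ≡⟨ cong₂ _+_ (ℰ-odd n) (cong₂ _*_ (sgn-even j) (𝒪-odd n)) ⟩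
    0ℤ + -1ℤ ^ suc j * P (suc j) oneₛ n                       ≡⟨ ℤP.+-identityˡ _ ⟩
    -1ℤ ^ suc j * P (suc j) oneₛ n                            ∎

module Ordinary = Chains {_≺_ = ℕ._≥_} suc (λ y≤1+m → y≤1+m) (λ y≤1+m → y≤1+m)

ordinary-closed : ∀ j →
  Ordinary.ℰ-series (double j) ≈ₛ (-1ℤ ^ j) ·ₛ Ordinary.𝒪-series (double j) ×
  mulFactors altSign (λ i → 2 ℕ.+ 2 ℕ.* i) j (Ordinary.𝒪-series (double j)) ≈ₛ oneₛ
ordinary-closed zero    =
  (λ n → trans (ℰ-series-zero n) (sym (trans (ℤP.*-identityˡ _) (𝒪-series-zero n)))) , 𝒪-series-zero
  where open Ordinary
ordinary-closed (suc j) = ℰ-even , Q-even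
  where
  open Ordinary
  c = altSign
  e : ℕ → ℕ
  e i = 2 ℕ.+ 2 ℕ.* i
  Q = mulFactors c e
  s = -1ℤ ^ j
  m = double j
  ℰ-odd : ℰ-series (suc m) ≈ₛ 0ₛ
  ℰ-odd = shift-fixed⇒0 (-1ℤ * s) m (ℰ-series (suc m)) λ n → begin
    ℰ-series (suc m) n                                     ≡⟨ ℰ-series-suc m n ⟩
    ℰ-series m n + sgn (suc m) * 𝒪-series (suc m) n
      ≡⟨ cong₂ _+_ (proj₁ (ordinary-closed j) n) (cong₂ _*_ (sgn-odd j) (𝒪-series-suc m n)) ⟩
    s * 𝒪-series m n + -1ℤ * s * (𝒪-series m n + shift (suc m) (ℰ-series (suc m)) n)
      ≡⟨ cancel s (𝒪-series m n) _ ⟩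
    -1ℤ * s * shift (suc m) (ℰ-series (suc m)) n         ∎
    where
    cancel : ∀ s a x → s * a + -1ℤ * s * (a + x) ≡ -1ℤ * s * x
    cancel = solve-∀
  𝒪-odd : 𝒪-series (suc m) ≈ₛ 𝒪-series m
  𝒪-odd n = begin
    𝒪-series (suc m) n                                    ≡⟨ 𝒪-series-suc m n ⟩
    𝒪-series m n + shift (suc m) (ℰ-series (suc m)) n
      ≡⟨ cong (_+_ (𝒪-series m n)) (trans (shift-cong (suc m) ℰ-odd n) (shift-0ₛ (suc m) n)) ⟩
    𝒪-series m n + 0ℤ                                     ≡⟨ ℤP.+-identityʳ _ ⟩
    𝒪-series m n                                          ∎
  ℰ-even : ℰ-series (suc (suc m)) ≈ₛ (-1ℤ ^ suc j) ·ₛ 𝒪-series (suc (suc m))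
  ℰ-even n = begin
    ℰ-series (suc (suc m)) n                                      ≡⟨ ℰ-series-suc (suc m) n ⟩
    ℰ-series (suc m) n + sgn (suc (suc m)) * 𝒪-series (suc (suc m)) n
      ≡⟨ cong₂ _+_ (ℰ-odd n) (cong (_* 𝒪-series (suc (suc m)) n) (sgn-even j)) ⟩
    0ℤ + -1ℤ ^ suc j * 𝒪-series (suc (suc m)) n                   ≡⟨ ℤP.+-identityˡ _ ⟩
    -1ℤ ^ suc j * 𝒪-series (suc (suc m)) n                        ∎
  last-factor : mulFactor (c j) (e j) (𝒪-series (suc (suc m))) ≈ₛ 𝒪-series m
  last-factor n = begin
    𝒪-series (suc (suc m)) n - c j * shift (e j) (𝒪-series (suc (suc m))) n
      ≡⟨ cong (λ d → 𝒪-series (suc (suc m)) n - c j * shift d (𝒪-series (suc (suc m))) n)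
              (cong (suc ∘ suc) (double≡2* j)) ⟨
    𝒪-series (suc (suc m)) n - c j * X
      ≡⟨ cong (λ y → y - c j * X) (𝒪-series-suc (suc m) n) ⟩
    𝒪-series (suc m) n + shift (suc (suc m)) (ℰ-series (suc (suc m))) n - c j * X
      ≡⟨ cong₂ (λ y z → y + z - c j * X) (𝒪-odd n)
           (trans (shift-cong (suc (suc m)) ℰ-even n)
                  (shift-scale (suc (suc m)) (c j) (𝒪-series (suc (suc m))) n)) ⟩
    𝒪-series m n + c j * X - c j * X                              ≡⟨ cancel (𝒪-series m n) (c j) X ⟩
    𝒪-series m n                                                  ∎
    where
    X = shift (suc (suc m)) (𝒪-series (suc (suc m))) n
    cancel : ∀ a c x → a + c * x - c * x ≡ a
    cancel = solve-∀
  Q-even : Q (suc j) (𝒪-series (suc (suc m))) ≈ₛ oneₛ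
  Q-even n = begin
    Q (suc j) (𝒪-series (suc (suc m))) n
      ≡⟨ mulFactors-mulFactor c e j (c j) (e j) (𝒪-series (suc (suc m))) n ⟨
    Q j (mulFactor (c j) (e j) (𝒪-series (suc (suc m)))) n    ≡⟨ mulFactors-cong c e j last-factor n ⟩
    Q j (𝒪-series m) n                                        ≡⟨ proj₂ (ordinary-closed j) n ⟩
    oneₛ n                                                    ∎

distinct-limit : Distinct.𝒪-limit ≈ₛ poch -1ℤ 1 -1ℤ 2
distinct-limit n = begin
  𝒪-series n n                                     ≡⟨ 𝒪-series-stable (n≤double[1+n] n) ⟨
  𝒪-series (double (suc n)) n                      ≡⟨ proj₁ (distinct-closed (suc n)) n ⟩
  infProd altSign (λ i → 1 ℕ.+ 2 ℕ.* i) n          ≡⟨ poch≈infProd -1ℤ 1 -1ℤ 2 n ⟨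
  poch -1ℤ 1 -1ℤ 2 n                               ∎
  where open Distinct

ordinary-product : (poch -1ℤ 2 -1ℤ 2 *ₛ Ordinary.𝒪-limit) ≈ₛ oneₛ
ordinary-product n = begin
  (poch -1ℤ 2 -1ℤ 2 *ₛ 𝒪-limit) n      ≡⟨ *ₛ-localˡ 𝒪-limit n (≈ₛ⇒≈[] (poch≈infProd -1ℤ 2 -1ℤ 2)) ⟩
  (infProd altSign e *ₛ 𝒪-limit) n
    ≡⟨ infProd-*ₛ altSign e (λ i → i<a+b*i {2} {2} i (s≤s z≤n) (s≤s z≤n)) 𝒪-limit n ⟩
  mulFactors altSign e (suc n) 𝒪-limit n
    ≡⟨ mulFactors-local altSign e (suc n)
         (λ k≤n → sym (𝒪-series-stable (ℕP.≤-trans k≤n (n≤double[1+n] n)))) ℕP.≤-refl ⟩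
  mulFactors altSign e (suc n) (𝒪-series (double (suc n))) n ≡⟨ proj₂ (ordinary-closed (suc n)) n ⟩
  oneₛ n                               ∎
  where
  open Ordinary
  e : ℕ → ℕ
  e i = 2 ℕ.+ 2 ℕ.* i

theorem4p5 : (∀ (n : ℕ) → HasCoeff IsDistinctPartition n (poch (- + 1) 1 (- + 1) 2 n)) ×
    (poch (- + 1) 1 (- + 1) 2 ≈ₛ (poch (- + 1) 1 (+ 1) 4 *ₛ poch (+ 1) 3 (+ 1) 4)) ×
    (∀ (n : ℕ) → HasCoeff IsPartition n (invₛ (poch (- + 1) 2 (- + 1) 2) n)) ×
    (invₛ (poch (- + 1) 2 (- + 1) 2)
      ≈ₛ invₛ (poch (- + 1) 2 (+ 1) 4 *ₛ poch (+ 1) 4 (+ 1) 4))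
theorem4p5 =
  (λ n → subst (HasCoeff IsDistinctPartition n) (distinct-limit n) (Distinct.hasCoeff n)) ,
  poch-split -1ℤ 1 2 (s≤s z≤n) (s≤s z≤n) ,
  (λ n → subst (HasCoeff IsPartition n) (sym (inverse n)) (Ordinary.hasCoeff n)) ,
  invₛ-cong (poch-split -1ℤ 2 2 (s≤s z≤n) (s≤s z≤n))
  where
  inverse : invₛ (poch -1ℤ 2 -1ℤ 2) ≈ₛ Ordinary.𝒪-limit
  inverse = invₛ-unique (poch -1ℤ 2 -1ℤ 2) Ordinary.𝒪-limit refl ordinary-product
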